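{- Let $G$ be a finite connected graph and consider any lion strategy on $G$ (with at least one lion). For every time $t\ge0$ and every nonempty set $S\subseteq W_t$ that induces a connected subgraph of $G$ and satisfies $N(S)\subseteq C_t$, we have $N(S)\cap L_t\neq\emptyset$.
   Context: Lions and contamination game on a finite graph $G=(V,E)$. For $S\subseteq V$, $N(S)=\{w\in V\setminus S:\exists v\in S,\{v,w\}\in E\}$ and $N(v)=N(\{v\})$. A lion strategy with $k\ge1$ lions: initial positions $p_i(0)$, and $p_i(t)\in\{p_i(t-1)\}\cup N(p_i(t-1))$ for $t\ge1$; $L_t=\{p_i(t)\}_i$, $\pi_t=\{(p_i(t-1),p_i(t))\}_i$. Contaminated sets: $W_0=V\setminus L_0$; $W_t=(W_{t-1}\setminus L_t)\cup\{v\in V\setminus L_t:\exists w\in W_{t-1}\cap N(v),\ (v,w)\notin\pi_t,(w,v)\notin\pi_t\}$; cleared sets $C_t=V\setminus W_t$. -}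

module Defs where

open import Data.Nat using (ℕ; zero; suc; _≤_)
open import Data.Fin using (Fin)
open import Data.Fin.Subset using (Subset; _∈_; _∉_)
open import Data.Product using (Σ; ∃; _×_; _,_)
open import Data.Sum using (_⊎_)
open import Data.Unit using (⊤)
open import Relation.Nullary using (¬_)
open import Relation.Binary using (Decidable)
open import Relation.Binary.PropositionalEquality using (_≡_)

record Graph (n : ℕ) : Set₁ where
  field
    Adj    : Fin n → Fin n → Set
    sym    : ∀ {u v} → Adj u v → Adj v u
    irrefl : ∀ {u} → ¬ Adj u u
    dec    : Decidable Adj

module _ {n : ℕ} (G : Graph n) where
  open Graph G

  data WalkIn (P : Fin n → Set) : Fin n → Fin n → Set where
    here : ∀ {u} → P u → WalkIn P u u
    step : ∀ {u w v} → P u → Adj u w → WalkIn P w v → WalkIn P u v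

  Connected : Set
  Connected = ∀ u v → WalkIn (λ _ → ⊤) u v

  InducesConnected : Subset n → Set
  InducesConnected S = ∀ u v → u ∈ S → v ∈ S → WalkIn (λ x → x ∈ S) u v

  InNbhd : Subset n → Fin n → Set
  InNbhd S w = w ∉ S × ∃ λ v → v ∈ S × Adj v w

  ValidStrategy : (k : ℕ) → (ℕ → Fin k → Fin n) → Set
  ValidStrategy k pos = ∀ t i → pos (suc t) i ≡ pos t i ⊎ Adj (pos t i) (pos (suc t) i)

  module Game {k : ℕ} (pos : ℕ → Fin k → Fin n) where
    InL : ℕ → Fin n → Set
    InL t v = ∃ λ i → pos t i ≡ v

    -- (v , w) ∈ π_{t+1}
    InPi : ℕ → Fin n → Fin n → Set
    InPi t v w = ∃ λ i → pos t i ≡ v × pos (suc t) i ≡ w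

    W : ℕ → Fin n → Set
    W zero v = ¬ InL zero v
    W (suc t) v = ¬ InL (suc t) v ×
      (W t v ⊎ ∃ λ w → W t w × Adj v w × ¬ InPi t v w × ¬ InPi t w v)

    C : ℕ → Fin n → Set
    C t v = ¬ W t v

module Submission where

open import Defs
open import Data.Nat using (ℕ; zero; suc; _≤_; s≤s)
open import Data.Fin using (Fin) renaming (zero to fzero)
open import Data.Fin.Subset using (Subset; _∈_)
open import Data.Fin.Subset.Properties using (_∈?_)
open import Data.Fin.Properties using (any?) renaming (_≟_ to _≟ᶠ_)
open import Data.Product using (∃; _×_; _,_; proj₁; proj₂)
open import Data.Sum using (inj₁; inj₂)
open import Relation.Nullary using (¬_; Dec; yes; no; contradiction)
open import Relation.Nullary.Decidable using (¬?; _×-dec_; _⊎-dec_)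
open import Relation.Unary using (Decidable; Satisfiable; _∩_)
open import Relation.Unary.Properties using (_∩?_)
open import Relation.Binary.PropositionalEquality using (refl; trans; subst)

-- At t = 0 a
-- walk from the set to a lion leaves it through a boundary vertex, which is
-- cleared only if it holds a lion.  From t + 1 to t, shrink the set to its
-- part that was already contaminated at time t: a boundary vertex that was
-- contaminated at t, or held a lion at t without that lion guarding an edge,
-- would have kept or spread the contamination into time t + 1.

module _ {n : ℕ} (G : Graph n) where
  open Graph G

  Boundary : (Fin n → Set) → Fin n → Set
  Boundary P w = ¬ P w × ∃ λ v → P v × Adj v w

  boundary? : {P : Fin n → Set} → Decidable P → Decidable (Boundary P)
  boundary? P? w = ¬? (P? w) ×-dec any? (λ v → P? v ×-dec dec v w)

  walk⇒boundary : ∀ {Q P : Fin n → Set} {a b} → Decidable P →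
                  WalkIn G Q a b → P a → ¬ P b → Satisfiable (Boundary P)
  walk⇒boundary P? (here _) pa ¬pb = contradiction pa ¬pb
  walk⇒boundary P? (step {w = w} _ a~w walk) pa ¬pb with P? w
  ... | yes pw = walk⇒boundary P? walk pw ¬pb
  ... | no ¬pw = w , ¬pw , _ , pa , a~w

  module _ {k : ℕ} (pos : ℕ → Fin k → Fin n) where
    open Game G pos

    InL? : ∀ t → Decidable (InL t)
    InL? t v = any? λ i → pos t i ≟ᶠ v

    InPi? : ∀ t v w → Dec (InPi t v w)
    InPi? t v w = any? λ i → (pos t i ≟ᶠ v) ×-dec (pos (suc t) i ≟ᶠ w)

    W? : ∀ t → Decidable (W t)
    W? zero    v = ¬? (InL? zero v)
    W? (suc t) v = ¬? (InL? (suc t) v) ×-dec (W? t v ⊎-dec any? λ w →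
      W? t w ×-dec dec v w ×-dec ¬? (InPi? t v w) ×-dec ¬? (InPi? t w v))

    W⇒¬InL : ∀ {t v} → W t v → ¬ InL t v
    W⇒¬InL {zero}  = λ w → w
    W⇒¬InL {suc t} = proj₁

    record Unguarded (t : ℕ) (P : Fin n → Set) : Set where
      field
        contaminated     : ∀ {v} → P v → W t v
        boundaryCleared  : ∀ {w} → Boundary P w → C t w
        boundaryLionFree : ∀ {w} → Boundary P w → ¬ InL t w

    module _ {t : ℕ} {P : Fin n → Set} (P? : Decidable P) (U : Unguarded (suc t) P) where
      open Unguarded U

      boundary⇒cleared : ∀ {w} → Boundary P w → C t w
      boundary⇒cleared ∂w w∈W = boundaryCleared ∂w (boundaryLionFree ∂w , inj₁ w∈W)

      contaminatedBefore : Satisfiable P → Satisfiable (P ∩ W t)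
      contaminatedBefore (v , pv) with contaminated pv
      ... | _ , inj₁ v∈W = v , pv , v∈W
      ... | _ , inj₂ (x , x∈W , v~x , _) with P? x
      ...   | yes px = x , px , x∈W
      ...   | no ¬px = contradiction x∈W (boundary⇒cleared (¬px , v , pv , v~x))

      -- Either the lion on w stays (so w ∈ P is not contaminated) or moves to a
      -- neighbour, which is in P or on its boundary; if w ∉ P, no lion crosses
      -- the edge from w into the contaminated P at time t + 1.
      unguardedBefore : ValidStrategy G k pos → Unguarded t (P ∩ W t)
      unguardedBefore valid = record
        { contaminated     = proj₂
        ; boundaryCleared  = cleared
        ; boundaryLionFree = lionFree
        }
        where
        cleared : ∀ {w} → Boundary (P ∩ W t) w → C t w
        cleared {w} (¬pw∩W , u , (pu , _) , u~w) w∈W with P? w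
        ... | yes pw = ¬pw∩W (pw , w∈W)
        ... | no ¬pw = boundary⇒cleared (¬pw , u , pu , u~w) w∈W

        lionFree : ∀ {w} → Boundary (P ∩ W t) w → ¬ InL t w
        lionFree {w} (¬pw∩W , u , (pu , u∈W) , u~w) (i , at-w) with P? w
        ... | no ¬pw = boundaryCleared ∂w
                         (boundaryLionFree ∂w , inj₂ (u , u∈W , sym u~w , noEntry , noExit))
          where
          ∂w : Boundary P w
          ∂w = ¬pw , u , pu , u~w
          noEntry : ¬ InPi t w u
          noEntry (j , _ , at-u) = W⇒¬InL (contaminated pu) (j , at-u)
          noExit : ¬ InPi t u w
          noExit (j , _ , at-w′) = boundaryLionFree ∂w (j , at-w′)
        ... | yes pw with valid t i
        ...   | inj₁ stays = W⇒¬InL (contaminated pw) (i , trans stays at-w)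
        ...   | inj₂ moves with P? (pos (suc t) i)
        ...     | yes pz = W⇒¬InL (contaminated pz) (i , refl)
        ...     | no ¬pz = boundaryLionFree
                             (¬pz , w , pw , subst (λ x → Adj x (pos (suc t) i)) at-w moves)
                             (i , refl)

    noUnguardedRegion : Connected G → ValidStrategy G k pos → Fin k →
                        ∀ t {P} → Decidable P → Satisfiable P → ¬ Unguarded t P
    noUnguardedRegion conn valid i zero {P} P? (v , pv) U =
      boundaryCleared (proj₂ exit) (boundaryLionFree (proj₂ exit))
      where
      open Unguarded U
      exit : Satisfiable (Boundary P)
      exit = walk⇒boundary P? (conn v (pos zero i)) pv (λ p → contaminated p (i , refl))
    noUnguardedRegion conn valid i (suc t) P? ne U =
      noUnguardedRegion conn valid i t (P? ∩? W? t)
        (contaminatedBefore P? U ne) (unguardedBefore P? U valid)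

lemma9 : ∀ {n : ℕ} (G : Graph n) → Connected G →
    (k : ℕ) → 1 ≤ k → (pos : ℕ → Fin k → Fin n) → ValidStrategy G k pos →
    (t : ℕ) (S : Subset n) →
    (∃ λ v → v ∈ S) →
    (∀ v → v ∈ S → Game.W G pos t v) →
    InducesConnected G S →
    (∀ w → InNbhd G S w → Game.C G pos t w) →
    ∃ λ w → InNbhd G S w × Game.InL G pos t w
lemma9 G conn (suc k) (s≤s _) pos valid t S ne S⊆W _ ∂S⊆C
  with any? (boundary? G (_∈? S) ∩? InL? G pos t)
... | yes guarded = guarded
... | no ¬guarded =
  contradiction S-unguarded (noUnguardedRegion G pos conn valid fzero t (_∈? S) ne)
  where
  S-unguarded : Unguarded G pos t (_∈ S)
  S-unguarded = record
    { contaminated     = S⊆W _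
    ; boundaryCleared  = ∂S⊆C _
    ; boundaryLionFree = λ ∂w l → ¬guarded (_ , ∂w , l)
    }
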